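{- Let $G_1$ and $G_2$ be two (non-oriented) derived graphs, and let $x_1\in V(G_1)$ and $x_2\in V(G_2)$. If $x_i$ is a global subordinate vertex of $G_i$ for $i=1,2$, then no dumbbell of $G_1$ and $G_2$ with respect to $x_1$ and $x_2$ is a derived graph.
   Context: A Burling tree is a 4-tuple $(T,r,\mathrm{last},\mathrm{choose})$ where $T$ is a tree rooted at $r$; $\mathrm{last}$ assigns to every non-leaf vertex $v$ one of its children (its last-born); and $\mathrm{choose}$ assigns to every vertex $v$ that is neither the root nor a last-born the vertex set of a (possibly empty) downward branch of $T$ starting at the last-born of the parent of $v$, with $\mathrm{choose}(v)=\emptyset$ for the root and last-borns. The oriented graph fully derived from $T$ has vertex set $V(T)$ and arc $uv$ iff $v\in\mathrm{choose}(u)$. An oriented graph is derived from $T$ if it is an induced subgraph of the graph fully derived from $T$; a non-oriented graph is derived if it is the underlying graph of an oriented derived graph. A hole is a chordless cycle of length at least $4$ (of the underlying graph). In an oriented graph $\tilde G$ derived from a Burling tree $T$, every hole $H$ has exactly two sources, called its antennas, and a (unique) vertex of $H$ adjacent to both antennas that is an ancestor in $T$ of every vertex of $H$ other than the antennas, called the pivot of $H$ (with respect to $T$). A subordinate vertex of $H$ is any vertex of $H$ other than its pivot and its antennas. A vertex $v$ of a non-oriented derived graph $G$ is a global subordinate vertex of $G$ if for every Burling tree $T$ and every oriented graph $\tilde G$ derived from $T$ whose underlying graph is $G$, $v$ is a subordinate vertex of some hole of $\tilde G$. Given graphs $G_1,G_2$ and $x_1\in V(G_1)$, $x_2\in V(G_2)$,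 a dumbbell of $G_1$ and $G_2$ with respect to $x_1$ and $x_2$ is obtained from the disjoint union of $G_1$ and $G_2$ by connecting $x_1$ and $x_2$ by a path of length at least $0$ with new internal vertices (length $0$ means identifying $x_1$ and $x_2$). -}

module Defs where

open import Data.Nat using (ℕ; zero; suc; _≤_)
open import Data.Fin using (Fin; toℕ)
open import Data.List using (List; []; _∷_)
open import Data.List.Membership.Propositional using (_∈_)
open import Data.Product using (Σ; ∃; _×_; _,_; proj₁)
open import Data.Sum using (_⊎_; inj₁; inj₂)
open import Data.Empty using (⊥)
open import Data.Unit using (⊤)
open import Relation.Nullary using (¬_)
open import Relation.Binary.PropositionalEquality using (_≡_; _≢_)
open import Function.Definitions using (Injective)

iter : {A : Set} → (A → A) → ℕ → A → A
iter f zero    a = a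
iter f (suc k) a = f (iter f k a)

IsChild : {m : ℕ} → Fin m → (Fin m → Fin m) → Fin m → Fin m → Set
IsChild root parent w v = (w ≢ root) × (parent w ≡ v)

Chain : {m : ℕ} → Fin m → (Fin m → Fin m) → Fin m → List (Fin m) → Set
Chain root parent b []       = ⊤
Chain root parent b (c ∷ cs) = IsChild root parent c b × Chain root parent c cs

DownBranch : {m : ℕ} → Fin m → (Fin m → Fin m) → Fin m → List (Fin m) → Set
DownBranch root parent a xs =
  (xs ≡ []) ⊎ (Σ (List _) λ cs → (xs ≡ a ∷ cs) × Chain root parent a cs)

record BurlingTree (m : ℕ) : Set where
  field
    root        : Fin m
    parent      : Fin m → Fin m
    parent-root : parent root ≡ root
    isTree      : ∀ v → ∃ λ k → iter parent k v ≡ root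
    last        : Fin m → Fin m
    last-child  : ∀ v → (∃ λ w → IsChild root parent w v) →
                  IsChild root parent (last v) v
    choose      : Fin m → List (Fin m)
    choose-root : choose root ≡ []
    choose-last : ∀ v → v ≢ root → last (parent v) ≡ v → choose v ≡ []
    choose-branch : ∀ v → v ≢ root → last (parent v) ≢ v →
                    DownBranch root parent (last (parent v)) (choose v)

module _ {m : ℕ} (T : BurlingTree m) where
  open BurlingTree T

  -- arc a → b of the graph fully derived from T
  Arc : Fin m → Fin m → Set
  Arc a b = b ∈ choose a

  Adj : Fin m → Fin m → Set
  Adj a b = Arc a b ⊎ Arc b a

  Ancestor : Fin m → Fin m → Set
  Ancestor a b = ∃ λ k → iter parent k b ≡ a

record Graph : Set₁ where
  field
    V : Set
    E : V → V → Set

open Graph public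

-- G is (isomorphic to) the underlying graph of the oriented graph
-- induced by the graph fully derived from T on the image of f
record Realization (G : Graph) {m : ℕ} (T : BurlingTree m) : Set where
  field
    f      : V G → Fin m
    f-inj  : Injective _≡_ _≡_ f
    adj⇒   : ∀ u v → E G u v → Adj T (f u) (f v)
    adj⇐   : ∀ u v → Adj T (f u) (f v) → E G u v

Derived : Graph → Set
Derived G = Σ ℕ λ m → Σ (BurlingTree m) λ T → Realization G T

CycNext : {k : ℕ} → Fin k → Fin k → Set
CycNext {k} i j = (toℕ j ≡ suc (toℕ i)) ⊎ ((suc (toℕ i) ≡ k) × (toℕ j ≡ 0))

module _ (G : Graph) {m : ℕ} (T : BurlingTree m) (ρ : Realization G T) where
  open Realization ρ

  ArcG : V G → V G → Set
  ArcG u v = Arc T (f u) (f v)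

  AdjG : V G → V G → Set
  AdjG u v = ArcG u v ⊎ ArcG v u

  record Hole : Set where
    field
      len     : ℕ
      len≥4   : 4 ≤ len
      h       : Fin len → V G
      h-inj   : Injective _≡_ _≡_ h
      cyc⇒    : ∀ i j → AdjG (h i) (h j) → CycNext i j ⊎ CycNext j i
      cyc⇐    : ∀ i j → CycNext i j ⊎ CycNext j i → AdjG (h i) (h j)

  module _ (H : Hole) where
    open Hole H

    IsAntenna : Fin len → Set
    IsAntenna i = ∀ j → ¬ ArcG (h j) (h i)

    IsPivot : Fin len → Set
    IsPivot i = (∀ j → IsAntenna j → AdjG (h i) (h j))
              × (∀ j → ¬ IsAntenna j → Ancestor T (f (h i)) (f (h j)))

    IsSubordinate : V G → Set
    IsSubordinate v = Σ (Fin len) λ i → (h i ≡ v) × ¬ IsAntenna i × ¬ IsPivot i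

GlobalSubordinate : (G : Graph) → V G → Set
GlobalSubordinate G v =
  ∀ m (T : BurlingTree m) (ρ : Realization G T) →
  Σ (Hole G T ρ) λ H → IsSubordinate G T ρ H v

SymClosure : {A : Set} → (A → A → Set) → A → A → Set
SymClosure R a b = R a b ⊎ R b a

-- length 0: x₂ is identified with x₁
module _ (G₁ G₂ : Graph) (x₁ : V G₁) (x₂ : V G₂) where

  V₀ : Set
  V₀ = V G₁ ⊎ Σ (V G₂) (λ b → b ≢ x₂)

  R₀ : V₀ → V₀ → Set
  R₀ (inj₁ a) (inj₁ b) = E G₁ a b
  R₀ (inj₂ a) (inj₂ b) = E G₂ (proj₁ a) (proj₁ b)
  R₀ (inj₁ a) (inj₂ b) = (a ≡ x₁) × E G₂ x₂ (proj₁ b)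
  R₀ (inj₂ a) (inj₁ b) = ⊥

  -- length k+1: path x₁ - p₀ - … - p_{k-1} - x₂ with k new internal vertices
  Vₚ : ℕ → Set
  Vₚ k = V G₁ ⊎ (V G₂ ⊎ Fin k)

  Rₚ : (k : ℕ) → Vₚ k → Vₚ k → Set
  Rₚ k (inj₁ a)        (inj₁ b)        = E G₁ a b
  Rₚ k (inj₂ (inj₁ a)) (inj₂ (inj₁ b)) = E G₂ a b
  Rₚ k (inj₂ (inj₂ i)) (inj₂ (inj₂ j)) = toℕ j ≡ suc (toℕ i)
  Rₚ k (inj₁ a)        (inj₂ (inj₂ i)) = (a ≡ x₁) × (toℕ i ≡ 0)
  Rₚ k (inj₂ (inj₂ i)) (inj₂ (inj₁ b)) = (b ≡ x₂) × (suc (toℕ i) ≡ k)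
  Rₚ k (inj₁ a)        (inj₂ (inj₁ b)) = (a ≡ x₁) × (b ≡ x₂) × (k ≡ 0)
  Rₚ k _               _               = ⊥

  Dumbbell : ℕ → Graph
  Dumbbell zero    = record { V = V₀ ; E = SymClosure R₀ }
  Dumbbell (suc k) = record { V = Vₚ k ; E = SymClosure (Rₚ k) }

{-# OPTIONS --safe #-}
-- Every arc u ⟶ v of a graph derived from a Burling tree ends in the subtree of the last-born
-- sibling of u. Hence, if d is a proper ancestor of v, every neighbour of v that is not adjacent
-- to d is again a descendant of d. Walking around a hole from an antenna shows that all its
-- vertices except the two antennas descend from the pivot, so a subordinate vertex x has a proper
-- ancestor a in its hole. Realise a dumbbell in a tree T and restrict to G₁ and G₂: the vertex a
-- above x₁ in a hole of G₁ is adjacent to no vertex outside G₁, so descent from a spreads from x₁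
-- along the handle to x₂ and around the hole of x₂, reaching the vertex b above x₂; by symmetry
-- b is also an ancestor of a, so a = b, which is impossible for vertices on different sides.

module Submission where

open import Defs
open import Data.Nat as ℕ using (ℕ; zero; suc; _+_; _*_; _∸_; s≤s; z≤n)
open import Data.Nat.Properties
  using (≤-total; m∸n+n≡m; *-comm; +-comm; <-irrefl; suc-injective; 1+n≢0; m<n+m; n<1+n; ≤⇒≯; ≤-trans; n≤1+n)
open import Data.Fin using (Fin; zero; suc; toℕ; fromℕ; inject₁; lower₁; _≟_; _≤_)
open import Data.Fin.Properties
  using (toℕ-injective; toℕ<n; toℕ-fromℕ; toℕ-inject₁; toℕ-lower₁; ≤fromℕ; ≤∧≢⇒<; ≤-antisym; any?)
open import Data.Fin.Induction using (<-weakInduction; <-weakInduction-startingFrom; >-weakInduction)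
open import Data.List using (List; _∷_)
open import Data.List.Membership.Propositional using (_∈_)
open import Data.List.Relation.Unary.Any using (here; there)
open import Data.Product using (Σ; ∃; _×_; _,_; proj₁; proj₂)
open import Data.Sum using (_⊎_; inj₁; inj₂; swap; [_,_])
open import Data.Sum.Properties using (inj₁-injective; inj₂-injective)
open import Data.Empty using (⊥; ⊥-elim)
open import Relation.Nullary using (¬_; Dec; yes; no; ¬?)
open import Relation.Nullary.Decidable using (decidable-stable)
open import Relation.Binary.PropositionalEquality hiding ([_])
open import Function using (_∘_; id)
open import Function.Definitions using (Injective)

module Ancestry {m : ℕ} (T : BurlingTree m) where
  open BurlingTree T

  infix 4 _≼_ _≺_

  _≼_ : Fin m → Fin m → Set
  _≼_ = Ancestor T

  _≺_ : Fin m → Fin m → Set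
  a ≺ v = a ≼ v × v ≢ a

  iter-parent-comm : ∀ k v → iter parent k (parent v) ≡ parent (iter parent k v)
  iter-parent-comm zero    v = refl
  iter-parent-comm (suc k) v = cong parent (iter-parent-comm k v)

  iter-+ : ∀ k l v → iter parent (k + l) v ≡ iter parent k (iter parent l v)
  iter-+ zero    l v = refl
  iter-+ (suc k) l v = cong parent (iter-+ k l v)

  iter-root : ∀ k → iter parent k root ≡ root
  iter-root zero    = refl
  iter-root (suc k) = trans (cong parent (iter-root k)) parent-root

  ≼-refl : ∀ {v} → v ≼ v
  ≼-refl = 0 , refl

  parent-≼ : ∀ v → parent v ≼ v
  parent-≼ v = 1 , refl

  ≼-trans : ∀ {a b c} → a ≼ b → b ≼ c → a ≼ c
  ≼-trans {c = c} (k , b↑k≡a) (l , c↑l≡b) =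
    k + l , trans (iter-+ k l c) (trans (cong (iter parent k) c↑l≡b) b↑k≡a)

  ≺⇒≼parent : ∀ {a v} → a ≺ v → a ≼ parent v
  ≺⇒≼parent ((zero  , v≡a) , v≢a) = ⊥-elim (v≢a v≡a)
  ≺⇒≼parent {v = v} ((suc k , v↑k≡a) , _) = k , trans (iter-parent-comm k v) v↑k≡a

  iter-∸ : ∀ {i j} v → i ℕ.≤ j → iter parent (j ∸ i) (iter parent i v) ≡ iter parent j v
  iter-∸ {i} {j} v i≤j =
    trans (sym (iter-+ (j ∸ i) i v)) (cong (λ n → iter parent n v) (m∸n+n≡m i≤j))

  ancestors-comparable : ∀ {a b v} → a ≼ v → b ≼ v → a ≼ b ⊎ b ≼ a
  ancestors-comparable {v = v} (k , refl) (l , refl) with ≤-total k l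
  ... | inj₁ k≤l = inj₂ (l ∸ k , iter-∸ v k≤l)
  ... | inj₂ l≤k = inj₁ (k ∸ l , iter-∸ v l≤k)

  iter-periodic : ∀ p v → iter parent p v ≡ v → ∀ t → iter parent (t * p) v ≡ v
  iter-periodic p v eq zero    = refl
  iter-periodic p v eq (suc t) =
    trans (iter-+ p (t * p) v) (trans (cong (iter parent p) (iter-periodic p v eq t)) eq)

  -- Going K times around the cycle, K being the distance from v to the root, ends at v and at the root.
  on-cycle⇒root : ∀ q v → iter parent (suc q) v ≡ v → v ≡ root
  on-cycle⇒root q v eq with isTree v
  ... | K , v↑K≡root = begin
    v                                ≡⟨ sym (iter-periodic (suc q) v eq K) ⟩
    iter parent (K * suc q) v        ≡⟨ cong (λ n → iter parent n v) K*[1+q]≡qK+K ⟩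
    iter parent (q * K + K) v        ≡⟨ iter-+ (q * K) K v ⟩
    iter parent (q * K) (iter parent K v) ≡⟨ cong (iter parent (q * K)) v↑K≡root ⟩
    iter parent (q * K) root         ≡⟨ iter-root (q * K) ⟩
    root                             ∎
    where
      open ≡-Reasoning
      K*[1+q]≡qK+K : K * suc q ≡ q * K + K
      K*[1+q]≡qK+K = trans (*-comm K (suc q)) (+-comm K (q * K))

  ≼-antisym : ∀ {a b} → a ≼ b → b ≼ a → a ≡ b
  ≼-antisym (zero , b≡a) _ = sym b≡a
  ≼-antisym {a} {b} (suc k , b↑k≡a) (l , a↑l≡b) = trans a≡root (sym b≡root)
    where
      a≡root : a ≡ root
      a≡root = on-cycle⇒root (k + l) a
        (trans (iter-+ (suc k) l a) (trans (cong (iter parent (suc k)) a↑l≡b) b↑k≡a))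
      b≡root : b ≡ root
      b≡root = trans (sym a↑l≡b) (trans (cong (iter parent l) a≡root) (iter-root l))

  siblings-incomparable : ∀ {c d p} → IsChild root parent c p → IsChild root parent d p →
                          c ≢ d → ¬ c ≼ d
  siblings-incomparable {c} (c≢root , pc≡p) (_ , pd≡p) c≢d c≼d =
    c≢root (on-cycle⇒root 0 c (sym c≡pc))
    where
      c≡pc : c ≡ parent c
      c≡pc = ≼-antisym (subst (c ≼_) (trans pd≡p (sym pc≡p)) (≺⇒≼parent (c≼d , c≢d ∘ sym)))
                       (parent-≼ c)

module Arcs {m : ℕ} (T : BurlingTree m) where
  open BurlingTree T
  open Ancestry T

  infix 4 _⟶_ _∼_

  _⟶_ : Fin m → Fin m → Set
  _⟶_ = Arc T

  _∼_ : Fin m → Fin m → Set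
  _∼_ = Adj T

  lastSibling : Fin m → Fin m
  lastSibling u = last (parent u)

  chain-≼ : ∀ {b cs v} → Chain root parent b cs → v ∈ b ∷ cs → b ≼ v
  chain-≼ _ (here refl) = ≼-refl
  chain-≼ {cs = _ ∷ _} ((_ , pc≡b) , ch) (there v∈) = ≼-trans (1 , pc≡b) (chain-≼ ch v∈)

  chain-convex : ∀ {b cs v d} → Chain root parent b cs → v ∈ b ∷ cs → b ≼ d → d ≼ v → d ∈ b ∷ cs
  chain-convex _ (here refl) b≼d d≼b = here (sym (≼-antisym b≼d d≼b))
  chain-convex {cs = c ∷ _} {d = d} ((_ , pc≡b) , ch) (there v∈) b≼d d≼v
    with ancestors-comparable (chain-≼ ch v∈) d≼v
  ... | inj₁ c≼d = there (chain-convex ch v∈ c≼d d≼v)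
  ... | inj₂ d≼c with d ≟ c
  ...   | yes d≡c = there (here d≡c)
  ...   | no d≢c = here (≼-antisym (subst (d ≼_) pc≡b (≺⇒≼parent (d≼c , d≢c ∘ sym))) b≼d)

  chain-comparable : ∀ {b cs v w} → Chain root parent b cs → v ∈ b ∷ cs → w ∈ b ∷ cs →
                     v ≼ w ⊎ w ≼ v
  chain-comparable ch (here refl) w∈ = inj₁ (chain-≼ ch w∈)
  chain-comparable ch v∈ (here refl) = inj₂ (chain-≼ ch v∈)
  chain-comparable {cs = _ ∷ _} (_ , ch) (there v∈) (there w∈) = chain-comparable ch v∈ w∈

  ⟶-source-nonroot : ∀ {u v} → u ⟶ v → u ≢ root
  ⟶-source-nonroot {u} {v} u⟶v u≡root
    with subst (v ∈_) (trans (cong choose u≡root) choose-root) u⟶v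
  ... | ()

  ⟶-source-not-lastborn : ∀ {u v} → u ⟶ v → lastSibling u ≢ u
  ⟶-source-not-lastborn {u} {v} u⟶v lastborn
    with subst (v ∈_) (choose-last u (⟶-source-nonroot u⟶v) lastborn) u⟶v
  ... | ()

  lastSibling-child : ∀ {u v} → u ⟶ v → IsChild root parent (lastSibling u) (parent u)
  lastSibling-child {u} u⟶v = last-child (parent u) (u , ⟶-source-nonroot u⟶v , refl)

  lastSibling-lastborn : ∀ {u v} → u ⟶ v → lastSibling (lastSibling u) ≡ lastSibling u
  lastSibling-lastborn u⟶v = cong last (proj₂ (lastSibling-child u⟶v))

  ⟶-branch : ∀ {u v} → u ⟶ v →
             Σ (List (Fin m)) λ cs →
               choose u ≡ lastSibling u ∷ cs × Chain root parent (lastSibling u) cs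
  ⟶-branch {u} {v} u⟶v
    with choose-branch u (⟶-source-nonroot u⟶v) (⟶-source-not-lastborn u⟶v)
  ... | inj₁ empty with subst (v ∈_) empty u⟶v
  ...   | ()
  ⟶-branch u⟶v | inj₂ branch = branch

  lastSibling-≼ : ∀ {u v} → u ⟶ v → lastSibling u ≼ v
  lastSibling-≼ {v = v} u⟶v with ⟶-branch u⟶v
  ... | _ , eq , ch = chain-≼ ch (subst (v ∈_) eq u⟶v)

  ⟶-convex : ∀ {u v d} → u ⟶ v → d ≼ v → lastSibling u ≼ d → u ⟶ d
  ⟶-convex {v = v} {d} u⟶v d≼v s≼d with ⟶-branch u⟶v
  ... | _ , eq , ch = subst (d ∈_) (sym eq) (chain-convex ch (subst (v ∈_) eq u⟶v) s≼d d≼v)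

  ⟶-targets-comparable : ∀ {u v w} → u ⟶ v → u ⟶ w → v ≼ w ⊎ w ≼ v
  ⟶-targets-comparable {v = v} {w} u⟶v u⟶w with ⟶-branch u⟶v
  ... | _ , eq , ch = chain-comparable ch (subst (v ∈_) eq u⟶v) (subst (w ∈_) eq u⟶w)

  -- The endpoints of an arc lie in different subtrees of two siblings.
  ⟶-incomparable : ∀ {u v} → u ⟶ v → ¬ u ≼ v × ¬ v ≼ u
  ⟶-incomparable {u} u⟶v = u⋠v , v⋠u
    where
      s : Fin m
      s = lastSibling u
      u-child : IsChild root parent u (parent u)
      u-child = ⟶-source-nonroot u⟶v , refl
      s-child : IsChild root parent s (parent u)
      s-child = lastSibling-child u⟶v
      s≢u : s ≢ u
      s≢u = ⟶-source-not-lastborn u⟶v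
      u⋠v : ¬ u ≼ _
      u⋠v u≼v with ancestors-comparable u≼v (lastSibling-≼ u⟶v)
      ... | inj₁ u≼s = siblings-incomparable u-child s-child (s≢u ∘ sym) u≼s
      ... | inj₂ s≼u = siblings-incomparable s-child u-child s≢u s≼u
      v⋠u : ¬ _ ≼ u
      v⋠u v≼u = siblings-incomparable s-child u-child s≢u (≼-trans (lastSibling-≼ u⟶v) v≼u)

  ⟶-descends : ∀ {d v w} → d ≺ v → v ⟶ w → d ≼ w
  ⟶-descends {v = v} d≺v v⟶w =
    ≼-trans (≺⇒≼parent d≺v)
            (≼-trans (1 , proj₂ (lastSibling-child v⟶w)) (lastSibling-≼ v⟶w))

  ⟶-ascends : ∀ {d v w} → w ⟶ v → d ≼ v → d ≼ w ⊎ w ⟶ d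
  ⟶-ascends {d} {w = w} w⟶v d≼v with ancestors-comparable (lastSibling-≼ w⟶v) d≼v
  ... | inj₁ s≼d = inj₂ (⟶-convex w⟶v d≼v s≼d)
  ... | inj₂ d≼s with d ≟ lastSibling w
  ...   | yes refl = inj₂ (⟶-convex w⟶v d≼v ≼-refl)
  ...   | no d≢s = inj₁ (≼-trans d≼pw (parent-≼ w))
    where
      d≼pw : d ≼ parent w
      d≼pw = subst (d ≼_) (proj₂ (lastSibling-child w⟶v)) (≺⇒≼parent (d≼s , d≢s ∘ sym))

  ≺-spreads : ∀ {d v w} → d ≺ v → v ∼ w → ¬ w ∼ d → d ≼ w
  ≺-spreads d≺v (inj₁ v⟶w) _ = ⟶-descends d≺v v⟶w
  ≺-spreads d≺v (inj₂ w⟶v) w≁d with ⟶-ascends w⟶v (proj₁ d≺v)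
  ... | inj₁ d≼w = d≼w
  ... | inj₂ w⟶d = ⊥-elim (w≁d (inj₁ w⟶d))

  ⟶-asym : ∀ {u v} → u ⟶ v → ¬ v ⟶ u
  ⟶-asym {u} {v} u⟶v v⟶u =
    siblings-incomparable (lastSibling-child u⟶v) (⟶-source-nonroot u⟶v , refl)
      (⟶-source-not-lastborn u⟶v) (⟶-descends (lastSibling-≼ u⟶v , v≢s) v⟶u)
    where
      -- a last-born has no out-arcs
      v≢s : v ≢ lastSibling u
      v≢s refl = ⟶-source-not-lastborn v⟶u (lastSibling-lastborn u⟶v)

  ∼-irrefl : ∀ {u} → ¬ u ∼ u
  ∼-irrefl (inj₁ u⟶u) = proj₁ (⟶-incomparable u⟶u) ≼-refl
  ∼-irrefl (inj₂ u⟶u) = proj₁ (⟶-incomparable u⟶u) ≼-refl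

  ∼⇒⋠ : ∀ {u v} → u ∼ v → ¬ u ≼ v
  ∼⇒⋠ (inj₁ u⟶v) = proj₁ (⟶-incomparable u⟶v)
  ∼⇒⋠ (inj₂ v⟶u) = proj₂ (⟶-incomparable v⟶u)

module Cycle where

  Consecutive : ∀ {n} → Fin n → Fin n → Set
  Consecutive i j = CycNext i j ⊎ CycNext j i

  next-unique : ∀ {n} {i j k : Fin n} → CycNext i j → CycNext i k → j ≡ k
  next-unique (inj₁ j≡1+i) (inj₁ k≡1+i) = toℕ-injective (trans j≡1+i (sym k≡1+i))
  next-unique (inj₂ (_ , j≡0)) (inj₂ (_ , k≡0)) = toℕ-injective (trans j≡0 (sym k≡0))
  next-unique {j = j} (inj₁ j≡1+i) (inj₂ (1+i≡n , _)) =
    ⊥-elim (<-irrefl (trans j≡1+i 1+i≡n) (toℕ<n j))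
  next-unique {k = k} (inj₂ (1+i≡n , _)) (inj₁ k≡1+i) =
    ⊥-elim (<-irrefl (trans k≡1+i 1+i≡n) (toℕ<n k))

  prev-unique : ∀ {n} {i j k : Fin n} → CycNext j i → CycNext k i → j ≡ k
  prev-unique (inj₁ i≡1+j) (inj₁ i≡1+k) =
    toℕ-injective (suc-injective (trans (sym i≡1+j) i≡1+k))
  prev-unique (inj₂ (1+j≡n , _)) (inj₂ (1+k≡n , _)) =
    toℕ-injective (suc-injective (trans 1+j≡n (sym 1+k≡n)))
  prev-unique (inj₁ i≡1+j) (inj₂ (_ , i≡0)) = ⊥-elim (1+n≢0 (trans (sym i≡1+j) i≡0))
  prev-unique (inj₂ (_ , i≡0)) (inj₁ i≡1+k) = ⊥-elim (1+n≢0 (trans (sym i≡1+k) i≡0))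

  next-exists : ∀ {n} (i : Fin n) → ∃ (CycNext i)
  next-exists {suc n} i with n ℕ.≟ toℕ i
  ... | yes n≡i = zero , inj₂ (cong suc (sym n≡i) , refl)
  ... | no n≢i = suc (lower₁ i n≢i) , inj₁ (cong suc (toℕ-lower₁ i n≢i))

  prev-exists : ∀ {n} (i : Fin n) → ∃ λ j → CycNext j i
  prev-exists {suc n} zero    = fromℕ n , inj₂ (cong suc (toℕ-fromℕ n) , refl)
  prev-exists {suc n} (suc i) = inject₁ i , inj₁ (cong suc (sym (toℕ-inject₁ i)))

  cycle-too-short : ∀ {n k} → 3 ℕ.≤ n → k ℕ.< 3 → n ≢ k
  cycle-too-short 3≤n k<3 refl = ≤⇒≯ 3≤n k<3

  next≢prev : ∀ {n} → 3 ℕ.≤ n → ∀ {i j k : Fin n} → CycNext i j → CycNext k i → j ≢ k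
  next≢prev _ {j = j} (inj₁ j≡1+i) (inj₁ i≡1+j) refl =
    <-irrefl (trans j≡1+i (cong suc i≡1+j)) (m<n+m (toℕ j) (s≤s z≤n))
  next≢prev 3≤n (inj₁ j≡1+i) (inj₂ (1+k≡n , i≡0)) refl = cycle-too-short 3≤n (n<1+n 2)
    (trans (sym 1+k≡n) (trans (cong suc j≡1+i) (cong (2 +_) i≡0)))
  next≢prev 3≤n (inj₂ (1+i≡n , j≡0)) (inj₁ i≡1+k) refl = cycle-too-short 3≤n (n<1+n 2)
    (trans (sym 1+i≡n) (trans (cong suc i≡1+k) (cong (2 +_) j≡0)))
  next≢prev 3≤n (inj₂ (1+i≡n , _)) (inj₂ (_ , i≡0)) refl =
    cycle-too-short 3≤n (m<n+m 1 {2} (s≤s z≤n))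
    (trans (sym 1+i≡n) (cong suc i≡0))

  cycNext-inject₁ : ∀ {n} (i : Fin n) → CycNext (inject₁ i) (suc i)
  cycNext-inject₁ i = inj₁ (cong suc (sym (toℕ-inject₁ i)))

  cycNext-fromℕ : ∀ n → CycNext (fromℕ n) zero
  cycNext-fromℕ n = inj₂ (cong suc (toℕ-fromℕ n) , refl)

  walk-forward : ∀ {n} (Q : Fin n → Set) {i₀} → Q i₀ →
                 (∀ {i j} → CycNext i j → Q i → Q j) → ∀ j → Q j
  walk-forward {suc n} Q {i₀} q₀ step =
    <-weakInduction Q (step (cycNext-fromℕ n) Q-last) (λ i → step (cycNext-inject₁ i))
    where
      Q-last : Q (fromℕ n)
      Q-last = <-weakInduction-startingFrom Q q₀ (λ i → step (cycNext-inject₁ i)) (≤fromℕ i₀)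

  walk-backward : ∀ {n} (Q : Fin n → Set) {i₀} → Q i₀ →
                  (∀ {i j} → CycNext j i → Q i → Q j) → ∀ j → Q j
  walk-backward {suc n} Q {i₀} q₀ step =
    >-weakInduction Q (step (cycNext-fromℕ n) (Q-below zero z≤n)) (λ i → step (cycNext-inject₁ i))
    where
      Q-below : ∀ j → j ≤ i₀ → Q j
      Q-below = >-weakInduction (λ j → j ≤ i₀ → Q j) base down
        where
          base : fromℕ n ≤ i₀ → Q (fromℕ n)
          base n≤i₀ = subst Q (≤-antisym (≤fromℕ i₀) n≤i₀) q₀
          down : ∀ i → (suc i ≤ i₀ → Q (suc i)) → inject₁ i ≤ i₀ → Q (inject₁ i)
          down i ih i≤i₀ with inject₁ i ≟ i₀
          ... | yes refl = q₀
          ... | no i≢i₀ = step (cycNext-inject₁ i)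
                            (ih (subst (λ x → suc x ℕ.≤ toℕ i₀) (toℕ-inject₁ i) (≤∧≢⇒< i≤i₀ i≢i₀)))

  data Direction : Set where
    forward backward : Direction

  reverse : Direction → Direction
  reverse forward  = backward
  reverse backward = forward

  Step : ∀ {n} → Direction → Fin n → Fin n → Set
  Step forward  i j = CycNext i j
  Step backward i j = CycNext j i

  reverse-step : ∀ {n} d {i j : Fin n} → Step (reverse d) i j → Step d j i
  reverse-step forward  s = s
  reverse-step backward s = s

  step-functional : ∀ {n} d {i j k : Fin n} → Step d i j → Step d i k → j ≡ k
  step-functional forward  = next-unique
  step-functional backward = prev-unique

  step-injective : ∀ {n} d {i j k : Fin n} → Step d j i → Step d k i → j ≡ k
  step-injective forward  = prev-unique
  step-injective backward = next-unique

  consecutive⇒step : ∀ {n} d {i j : Fin n} → Consecutive i j → Step d i j ⊎ Step d j i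
  consecutive⇒step forward  c = c
  consecutive⇒step backward c = swap c

  step⇒consecutive : ∀ {n} d {i j : Fin n} → Step d i j → Consecutive i j
  step⇒consecutive forward  s = inj₁ s
  step⇒consecutive backward s = inj₂ s

  step-direction : ∀ {n} {i j : Fin n} → Consecutive i j → ∃ λ d → Step d i j
  step-direction (inj₁ s) = forward , s
  step-direction (inj₂ s) = backward , s

  walk : ∀ {n} d (Q : Fin n → Set) {i₀} → Q i₀ → (∀ {i j} → Step d i j → Q i → Q j) → ∀ j → Q j
  walk forward  = walk-forward
  walk backward = walk-backward

  walk-avoiding : ∀ {n} d (Q : Fin n → Set) {i₀} → Q i₀ →
                  (∀ {i j} → Step d i j → j ≢ i₀ → Q i → Q j) → ∀ j → Q j
  walk-avoiding d Q {i₀} q₀ step = walk d Q q₀ step′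
    where
      step′ : ∀ {i j} → Step d i j → Q i → Q j
      step′ {j = j} s q with j ≟ i₀
      ... | yes refl = q₀
      ... | no j≢i₀ = step s j≢i₀ q

module HoleShape (G : Graph) {m : ℕ} (T : BurlingTree m) (ρ : Realization G T) (H : Hole G T ρ) where
  open BurlingTree T using (choose)
  open import Data.List.Membership.DecPropositional (_≟_ {m}) using (_∈?_)
  open Hole H
  open Realization ρ
  open Ancestry T
  open Arcs T
  open Cycle

  F : Fin len → Fin m
  F t = f (h t)

  infix 4 _⇀_ _~_

  _⇀_ : Fin len → Fin len → Set
  i ⇀ j = F i ⟶ F j

  _~_ : Fin len → Fin len → Set
  i ~ j = F i ∼ F j

  Antenna : Fin len → Set
  Antenna = IsAntenna G T ρ H

  F-injective : ∀ {i j} → F i ≡ F j → i ≡ j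
  F-injective = h-inj ∘ f-inj

  ~-sym : ∀ {i j} → i ~ j → j ~ i
  ~-sym (inj₁ i⇀j) = inj₂ i⇀j
  ~-sym (inj₂ j⇀i) = inj₁ j⇀i

  ~⇒step : ∀ d {i j} → i ~ j → Step d i j ⊎ Step d j i
  ~⇒step d i~j = consecutive⇒step d (cyc⇒ _ _ i~j)

  step⇒~ : ∀ d {i j} → Step d i j → i ~ j
  step⇒~ d s = cyc⇐ _ _ (step⇒consecutive d s)

  ~-other : ∀ {i a b c} → i ~ a → i ~ b → a ≢ b → i ~ c → c ≡ a ⊎ c ≡ b
  ~-other i~a i~b a≢b i~c with cyc⇒ _ _ i~a | cyc⇒ _ _ i~b | cyc⇒ _ _ i~c
  ... | inj₁ a-next | inj₁ b-next | _ = ⊥-elim (a≢b (next-unique a-next b-next))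
  ... | inj₂ a-prev | inj₂ b-prev | _ = ⊥-elim (a≢b (prev-unique a-prev b-prev))
  ... | inj₁ a-next | inj₂ _      | inj₁ c-next = inj₁ (next-unique c-next a-next)
  ... | inj₁ _      | inj₂ b-prev | inj₂ c-prev = inj₂ (prev-unique c-prev b-prev)
  ... | inj₂ _      | inj₁ b-next | inj₁ c-next = inj₂ (next-unique c-next b-next)
  ... | inj₂ a-prev | inj₁ _      | inj₂ c-prev = inj₁ (prev-unique c-prev a-prev)

  two-neighbours : ∀ i → Σ (Fin len) λ a → Σ (Fin len) λ b → i ~ a × i ~ b × a ≢ b
  two-neighbours i with next-exists i | prev-exists i
  ... | a , a-next | b , b-prev =
    a , b , cyc⇐ _ _ (inj₁ a-next) , cyc⇐ _ _ (inj₂ b-prev) , next≢prev 3≤len a-next b-prev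
    where
      3≤len : 3 ℕ.≤ len
      3≤len = ≤-trans (n≤1+n 3) len≥4

  other-neighbour : ∀ {i a} → i ~ a → Σ (Fin len) λ b → i ~ b × b ≢ a
  other-neighbour {a = a} i~a with two-neighbours _
  ... | x , y , i~x , i~y , x≢y with x ≟ a
  ...   | yes refl = y , i~y , x≢y ∘ sym
  ...   | no x≢a = x , i~x , x≢a

  record Frame (w : Fin len) : Set where
    field
      pivot far    : Fin len
      w⇀pivot      : w ⇀ pivot
      pivot~far    : pivot ~ far
      far-antenna  : Antenna far
      around-pivot : ∀ t → t ≡ w ⊎ t ≡ far ⊎ F pivot ≼ F t

  module FrameOf {w p q z} (w⇀p : w ⇀ p) (w⇀q : w ⇀ q) (p≢q : p ≢ q) (p≼q : F p ≼ F q)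
                 (p~z : p ~ z) (z≢w : z ≢ w) where

    p-neighbours : ∀ {j} → p ~ j → j ≡ w ⊎ j ≡ z
    p-neighbours = ~-other (inj₂ w⇀p) p~z (z≢w ∘ sym)

    -- Walk around the hole from w through q: the first vertex is below p, and the
    -- walk can only leave the subtree of p through a neighbour of p.
    around-p : ∀ t → t ≡ w ⊎ t ≡ z ⊎ F p ≼ F t
    around-p with step-direction (cyc⇒ _ _ (inj₁ w⇀q))
    ... | d , w↦q = walk-avoiding d Q (inj₁ refl) step
      where
        Q : Fin len → Set
        Q t = t ≡ w ⊎ t ≡ z ⊎ F p ≼ F t
        p↦w : Step d p w
        p↦w with ~⇒step d (inj₂ w⇀p)
        ... | inj₁ p↦w = p↦w
        ... | inj₂ w↦p = ⊥-elim (p≢q (step-functional d w↦p w↦q))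
        z↦p : Step d z p
        z↦p with ~⇒step d (~-sym p~z)
        ... | inj₁ z↦p = z↦p
        ... | inj₂ p↦z = ⊥-elim (z≢w (step-functional d p↦z p↦w))
        step : ∀ {i j} → Step d i j → j ≢ w → Q i → Q j
        step i↦j _ (inj₁ refl) =
          inj₂ (inj₂ (subst (λ t → F p ≼ F t) (step-functional d w↦q i↦j) p≼q))
        step i↦j _ (inj₂ (inj₁ refl)) =
          inj₂ (inj₂ (subst (λ t → F p ≼ F t) (step-functional d z↦p i↦j) ≼-refl))
        step {i} {j} i↦j j≢w (inj₂ (inj₂ p≼i)) with i ≟ p | j ≟ z
        ... | yes refl | _ = ⊥-elim (j≢w (step-functional d i↦j p↦w))
        ... | no _ | yes j≡z = inj₂ (inj₁ j≡z)
        ... | no i≢p | no j≢z =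
          inj₂ (inj₂ (≺-spreads (p≼i , i≢p ∘ F-injective) (step⇒~ d i↦j) j≁p))
          where
            j≁p : ¬ j ~ p
            j≁p j~p with p-neighbours (~-sym j~p)
            ... | inj₁ j≡w = j≢w j≡w
            ... | inj₂ j≡z = j≢z j≡z

    z-antenna : Antenna z
    z-antenna j j⇀z with other-neighbour (~-sym p~z)
    ... | y , z~y , y≢p = from (~-other (~-sym p~z) z~y (y≢p ∘ sym) (inj₂ j⇀z))
      where
        p⋠z : ¬ F p ≼ F z
        p⋠z = ∼⇒⋠ p~z
        w≁z : ¬ w ~ z
        w≁z w~z with ~-other (inj₁ w⇀p) (inj₁ w⇀q) p≢q w~z
        ... | inj₁ refl = ∼-irrefl p~z
        ... | inj₂ refl = ∼⇒⋠ p~z p≼q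
        p≺y : F p ≺ F y
        p≺y with around-p y
        ... | inj₁ refl = ⊥-elim (w≁z (~-sym z~y))
        ... | inj₂ (inj₁ refl) = ⊥-elim (∼-irrefl z~y)
        ... | inj₂ (inj₂ p≼y) = p≼y , y≢p ∘ F-injective
        from : j ≡ p ⊎ j ≡ y → ⊥
        from (inj₂ j≡y) = p⋠z (⟶-descends p≺y (subst (_⇀ z) j≡y j⇀z))
        from (inj₁ j≡p) = no-arc-from-p (subst (_⇀ z) j≡p j⇀z) z~y
          where
            no-arc-from-p : p ⇀ z → z ~ y → ⊥
            no-arc-from-p _ (inj₂ y⇀z) = p⋠z (⟶-descends p≺y y⇀z)
            no-arc-from-p p⇀z (inj₁ z⇀y) with ⟶-ascends z⇀y (proj₁ p≺y)
            ... | inj₁ p≼z = p⋠z p≼z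
            ... | inj₂ z⇀p = ⟶-asym p⇀z z⇀p

  frame-from-ordered : ∀ {w p q} → w ⇀ p → w ⇀ q → p ≢ q → F p ≼ F q → Frame w
  frame-from-ordered w⇀p w⇀q p≢q p≼q with other-neighbour (inj₂ w⇀p)
  ... | z , p~z , z≢w = record
    { pivot = _ ; far = z ; w⇀pivot = w⇀p ; pivot~far = p~z
    ; far-antenna = FrameOf.z-antenna w⇀p w⇀q p≢q p≼q p~z z≢w
    ; around-pivot = FrameOf.around-p w⇀p w⇀q p≢q p≼q p~z z≢w
    }

  antenna-out : ∀ {w x} → Antenna w → w ~ x → w ⇀ x
  antenna-out _         (inj₁ w⇀x) = w⇀x
  antenna-out w-antenna (inj₂ x⇀w) = ⊥-elim (w-antenna _ x⇀w)

  frame-from-out-neighbours : ∀ {w a b} → w ⇀ a → w ⇀ b → a ≢ b → Frame w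
  frame-from-out-neighbours w⇀a w⇀b a≢b with ⟶-targets-comparable w⇀a w⇀b
  ... | inj₁ a≼b = frame-from-ordered w⇀a w⇀b a≢b a≼b
  ... | inj₂ b≼a = frame-from-ordered w⇀b w⇀a (a≢b ∘ sym) b≼a

  frame : ∀ w → Antenna w → Frame w
  frame w w-antenna with two-neighbours w
  ... | _ , _ , w~a , w~b , a≢b =
    frame-from-out-neighbours (antenna-out w-antenna w~a) (antenna-out w-antenna w~b) a≢b

  -- Orient the cycle so that every vertex receives an in-arc from its successor; then
  -- walking backwards keeps the whole hole below the last sibling of one of its vertices.
  in-arcs-everywhere-impossible : Fin len → ¬ (∀ t → ∃ λ k → k ⇀ t)
  in-arcs-everywhere-impossible s in-arc with in-arc s
  ... | k , k⇀s with step-direction (cyc⇒ _ _ (inj₂ k⇀s))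
  ...   | d , s↦k =
    siblings-incomparable (lastSibling-child k⇀s) (⟶-source-nonroot k⇀s , refl)
      (⟶-source-not-lastborn k⇀s) (below-D k)
    where
      In-arc-from-successor : Fin len → Set
      In-arc-from-successor t = ∃ λ j → Step d t j × j ⇀ t

      from-successor : ∀ t → In-arc-from-successor t
      from-successor = walk d In-arc-from-successor (k , s↦k , k⇀s) step
        where
          step : ∀ {i j} → Step d i j → In-arc-from-successor i → In-arc-from-successor j
          step {i} {j} i↦j (j′ , i↦j′ , j′⇀i) with in-arc j
          ... | k′ , k′⇀j with ~⇒step d (inj₂ k′⇀j)
          ...   | inj₁ j↦k′ = k′ , j↦k′ , k′⇀j
          ...   | inj₂ k′↦j =
            ⊥-elim (⟶-asym (subst (_⇀ j) (step-injective d k′↦j i↦j) k′⇀j)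
                           (subst (_⇀ i) (step-functional d i↦j′ i↦j) j′⇀i))

      D : Fin m
      D = lastSibling (F k)

      below-D : ∀ t → D ≼ F t
      below-D = walk (reverse d) (λ t → D ≼ F t) (lastSibling-≼ k⇀s) step
        where
          step : ∀ {i j} → Step (reverse d) i j → D ≼ F i → D ≼ F j
          step {i} {j} i↦j D≼i with from-successor j
          ... | i′ , j↦i′ , i′⇀j = ⟶-descends (D≼i , Fi≢D) i⇀j
            where
              i⇀j : i ⇀ j
              i⇀j = subst (_⇀ j) (step-functional d j↦i′ (reverse-step d i↦j)) i′⇀j
              Fi≢D : F i ≢ D
              Fi≢D Fi≡D = ⟶-source-not-lastborn i⇀j
                (trans (cong lastSibling Fi≡D) (trans (lastSibling-lastborn k⇀s) (sym Fi≡D)))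

  in-arc? : ∀ t → Dec (∃ λ k → k ⇀ t)
  in-arc? t = any? (λ k → F t ∈? choose (F k))

  antenna-exists : Fin len → ∃ Antenna
  antenna-exists s with any? (λ t → ¬? (in-arc? t))
  ... | yes (w , no-in-arc) = w , λ k k⇀w → no-in-arc (k , k⇀w)
  ... | no no-antenna = ⊥-elim (in-arcs-everywhere-impossible s λ t →
          decidable-stable (in-arc? t) λ no-in-arc → no-antenna (t , no-in-arc))

  -- By the frame of j, the pivot of j lies above the pivot of w, hence above j itself.
  antenna-below-pivot-impossible : ∀ {w j} (fr : Frame w) → Antenna j → ¬ F (Frame.pivot fr) ≼ F j
  antenna-below-pivot-impossible {w} {j} fr j-antenna pivot≼j
    with Frame.around-pivot (frame j j-antenna) (Frame.pivot fr)
  ... | inj₁ pivot≡j = j-antenna w (subst (w ⇀_) pivot≡j (Frame.w⇀pivot fr))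
  ... | inj₂ (inj₁ pivot≡far) =
    Frame.far-antenna (frame j j-antenna) w (subst (w ⇀_) pivot≡far (Frame.w⇀pivot fr))
  ... | inj₂ (inj₂ pivot′≼pivot) =
    proj₂ (⟶-incomparable (Frame.w⇀pivot (frame j j-antenna))) (≼-trans pivot′≼pivot pivot≼j)

  frame-pivot-isPivot : ∀ {w} → Antenna w → (fr : Frame w) → IsPivot G T ρ H (Frame.pivot fr)
  frame-pivot-isPivot w-antenna fr = adjacent-to-antennas , above-the-rest
    where
      open Frame fr
      adjacent-to-antennas : ∀ j → Antenna j → pivot ~ j
      adjacent-to-antennas j j-antenna with around-pivot j
      ... | inj₁ refl = inj₂ w⇀pivot
      ... | inj₂ (inj₁ refl) = pivot~far
      ... | inj₂ (inj₂ pivot≼j) = ⊥-elim (antenna-below-pivot-impossible fr j-antenna pivot≼j)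
      above-the-rest : ∀ j → ¬ Antenna j → F pivot ≼ F j
      above-the-rest j not-antenna with around-pivot j
      ... | inj₁ refl = ⊥-elim (not-antenna w-antenna)
      ... | inj₂ (inj₁ refl) = ⊥-elim (not-antenna far-antenna)
      ... | inj₂ (inj₂ pivot≼j) = pivot≼j

  subordinate-has-ancestor-in-hole : ∀ {v} → IsSubordinate G T ρ H v → ∃ λ k → F k ≺ f v
  subordinate-has-ancestor-in-hole (i , refl , not-antenna , not-pivot) with antenna-exists i
  ... | w , w-antenna = from (around-pivot i)
    where
      open Frame (frame w w-antenna)
      from : i ≡ w ⊎ i ≡ far ⊎ F pivot ≼ F i → ∃ λ k → F k ≺ F i
      from (inj₁ i≡w) = ⊥-elim (not-antenna (subst Antenna (sym i≡w) w-antenna))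
      from (inj₂ (inj₁ i≡far)) = ⊥-elim (not-antenna (subst Antenna (sym i≡far) far-antenna))
      from (inj₂ (inj₂ pivot≼i)) with i ≟ pivot
      ... | yes i≡pivot = ⊥-elim (not-pivot (subst (IsPivot G T ρ H) (sym i≡pivot)
                                 (frame-pivot-isPivot w-antenna (frame w w-antenna))))
      ... | no i≢pivot = pivot , pivot≼i , i≢pivot ∘ F-injective

  ≺-spreads-around : ∀ {i₀ P} → P ≺ F i₀ → (∀ t → t ≢ i₀ → ¬ F t ∼ P × F t ≢ P) → ∀ t → P ≼ F t
  ≺-spreads-around {P = P} P≺i₀ apart t =
    proj₁ (walk-avoiding forward (λ t → P ≺ F t) P≺i₀ step t)
    where
      step : ∀ {i j} → CycNext i j → j ≢ _ → P ≺ F i → P ≺ F j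
      step i↦j j≢i₀ P≺i =
        ≺-spreads P≺i (step⇒~ forward i↦j) (proj₁ (apart _ j≢i₀)) , proj₂ (apart _ j≢i₀)

module Realized {G : Graph} {m : ℕ} {T : BurlingTree m} (ρ : Realization G T) where
  open Realization ρ
  open Ancestry T
  open Arcs T

  edge-sym : ∀ {u v} → E G u v → E G v u
  edge-sym {u} {v} e = adj⇐ v u (swap (adj⇒ u v e))

  edge-irrefl : ∀ {v} → ¬ E G v v
  edge-irrefl {v} e = ∼-irrefl (adj⇒ v v e)

  vertex-≟ : (u v : V G) → Dec (u ≡ v)
  vertex-≟ u v with f u ≟ f v
  ... | yes fu≡fv = yes (f-inj fu≡fv)
  ... | no fu≢fv = no (fu≢fv ∘ cong f)

  Apart : V G → V G → Set
  Apart p v = ¬ E G v p × v ≢ p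

  ≺⇒≢ : ∀ {p v} → f p ≺ f v → p ≢ v
  ≺⇒≢ p≺v p≡v = proj₂ p≺v (cong f (sym p≡v))

  apart-in-tree : ∀ {p v} → Apart p v → ¬ f v ∼ f p × f v ≢ f p
  apart-in-tree {p} {v} (v≁p , v≢p) = v≁p ∘ adj⇐ v p , v≢p ∘ f-inj

  apart-sym : ∀ {p v} → Apart p v → Apart v p
  apart-sym (v≁p , v≢p) = v≁p ∘ edge-sym , v≢p ∘ sym

  ≺-spreads-along-edge : ∀ {p u v} → f p ≺ f u → E G u v → Apart p v → f p ≺ f v
  ≺-spreads-along-edge {u = u} {v} p≺u e p∥v =
    ≺-spreads p≺u (adj⇒ u v e) (proj₁ (apart-in-tree p∥v)) , proj₂ (apart-in-tree p∥v)

  restrict : ∀ {H : Graph} (ι : V H → V G) → Injective _≡_ _≡_ ι →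
             (∀ {u v} → E H u v → E G (ι u) (ι v)) → (∀ {u v} → E G (ι u) (ι v) → E H u v) →
             Realization H T
  restrict ι ι-inj preserves reflects = record
    { f = f ∘ ι ; f-inj = ι-inj ∘ f-inj
    ; adj⇒ = λ u v → adj⇒ (ι u) (ι v) ∘ preserves
    ; adj⇐ = λ u v → reflects ∘ adj⇐ (ι u) (ι v) }

module Linking {m : ℕ} (T : BurlingTree m) where
  open Ancestry T
  open Arcs T
  open Realization

  record Linked {G₁ G₂ : Graph} (ρ₁ : Realization G₁ T) (ρ₂ : Realization G₂ T)
                (x₁ : V G₁) (x₂ : V G₂) : Set where
    field
      apart  : ∀ a → a ≢ x₁ → ∀ b → b ≢ x₂ → ¬ f ρ₂ b ∼ f ρ₁ a × f ρ₂ b ≢ f ρ₁ a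
      bridge : ∀ a → a ≢ x₁ → f ρ₁ a ≺ f ρ₁ x₁ → f ρ₁ a ≺ f ρ₂ x₂

  module _ {G₁ G₂ : Graph} {ρ₁ : Realization G₁ T} {ρ₂ : Realization G₂ T} {x₁ : V G₁} {x₂ : V G₂}
           (L : Linked ρ₁ ρ₂ x₁ x₂) where
    open Linked L

    ≺-spreads-over-linked-hole : (H : Hole G₂ T ρ₂) → ∀ {i} → Hole.h H i ≡ x₂ →
                                 ∀ {a} → f ρ₁ a ≺ f ρ₁ x₁ → ∀ t → f ρ₁ a ≼ f ρ₂ (Hole.h H t)
    ≺-spreads-over-linked-hole H {i} hi≡x₂ {a} a≺x₁ =
      HoleShape.≺-spreads-around G₂ T ρ₂ H a≺hi λ t t≢i → apart a a≢x₁ (Hole.h H t) (ht≢x₂ t≢i)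
      where
        a≢x₁ : a ≢ x₁
        a≢x₁ = Realized.≺⇒≢ ρ₁ a≺x₁
        a≺hi : f ρ₁ a ≺ f ρ₂ (Hole.h H i)
        a≺hi = subst (λ v → f ρ₁ a ≺ f ρ₂ v) (sym hi≡x₂) (bridge a a≢x₁ a≺x₁)
        ht≢x₂ : ∀ {t} → t ≢ i → Hole.h H t ≢ x₂
        ht≢x₂ t≢i ht≡x₂ = t≢i (Hole.h-inj H (trans ht≡x₂ (sym hi≡x₂)))

  linked-subordinates-impossible :
    ∀ {G₁ G₂ : Graph} {ρ₁ : Realization G₁ T} {ρ₂ : Realization G₂ T} {x₁ : V G₁} {x₂ : V G₂} →
    Linked ρ₁ ρ₂ x₁ x₂ → Linked ρ₂ ρ₁ x₂ x₁ → GlobalSubordinate G₁ x₁ → GlobalSubordinate G₂ x₂ → ⊥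
  linked-subordinates-impossible {G₁} {G₂} {ρ₁} {ρ₂} L₁₂ L₂₁ sub₁ sub₂
    with sub₁ m T ρ₁ | sub₂ m T ρ₂
  ... | H₁ , x₁∈H₁ | H₂ , x₂∈H₂
    with HoleShape.subordinate-has-ancestor-in-hole G₁ T ρ₁ H₁ x₁∈H₁
       | HoleShape.subordinate-has-ancestor-in-hole G₂ T ρ₂ H₂ x₂∈H₂
  ... | k₁ , a≺x₁ | k₂ , b≺x₂ =
    proj₂ (Linked.apart L₁₂ _ (Realized.≺⇒≢ ρ₁ a≺x₁) _ (Realized.≺⇒≢ ρ₂ b≺x₂)) (≼-antisym b≼a a≼b)
    where
      a≼b : f ρ₁ (Hole.h H₁ k₁) ≼ f ρ₂ (Hole.h H₂ k₂)
      a≼b = ≺-spreads-over-linked-hole L₁₂ H₂ (proj₁ (proj₂ x₂∈H₂)) a≺x₁ k₂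
      b≼a : f ρ₂ (Hole.h H₂ k₂) ≼ f ρ₁ (Hole.h H₁ k₁)
      b≼a = ≺-spreads-over-linked-hole L₂₁ H₁ (proj₁ (proj₂ x₁∈H₁)) b≺x₂ k₁

module Dumbbells (G₁ G₂ : Graph) (x₁ : V G₁) (x₂ : V G₂) (d₁ : Derived G₁) (d₂ : Derived G₂)
                 {m : ℕ} (T : BurlingTree m) where
  open Ancestry T
  open Linking T
  open Realization using (f)

  edge-sym₁ : ∀ {u v} → E G₁ u v → E G₁ v u
  edge-sym₁ = Realized.edge-sym (proj₂ (proj₂ d₁))

  edge-sym₂ : ∀ {u v} → E G₂ u v → E G₂ v u
  edge-sym₂ = Realized.edge-sym (proj₂ (proj₂ d₂))

  record LinkedRealizations : Set where
    field
      ρ₁ : Realization G₁ T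
      ρ₂ : Realization G₂ T
      linked₁₂ : Linked ρ₁ ρ₂ x₁ x₂
      linked₂₁ : Linked ρ₂ ρ₁ x₂ x₁

  module PathDumbbell (k : ℕ) (ρ : Realization (Dumbbell G₁ G₂ x₁ x₂ (suc k)) T) where
    open Realized ρ

    side₁ : V G₁ → Vₚ G₁ G₂ x₁ x₂ k
    side₁ = inj₁

    side₂ : V G₂ → Vₚ G₁ G₂ x₁ x₂ k
    side₂ = inj₂ ∘ inj₁

    inner : Fin k → Vₚ G₁ G₂ x₁ x₂ k
    inner = inj₂ ∘ inj₂

    ρ₁ : Realization G₁ T
    ρ₁ = restrict side₁ inj₁-injective inj₁ [ id , edge-sym₁ ]

    ρ₂ : Realization G₂ T
    ρ₂ = restrict side₂ (inj₁-injective ∘ inj₂-injective) inj₁ [ id , edge-sym₂ ]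

    apart-from-side₁ : ∀ {a} → a ≢ x₁ → ∀ v → Apart (side₁ a) (inj₂ v)
    apart-from-side₁ {a} a≢x₁ v = no-edge v , λ ()
      where
        no-edge : ∀ v → ¬ E (Dumbbell G₁ G₂ x₁ x₂ (suc k)) (inj₂ v) (side₁ a)
        no-edge (inj₁ _) (inj₁ ())
        no-edge (inj₂ _) (inj₁ ())
        no-edge (inj₁ _) (inj₂ (a≡x₁ , _)) = a≢x₁ a≡x₁
        no-edge (inj₂ _) (inj₂ (a≡x₁ , _)) = a≢x₁ a≡x₁

    apart-side₁-from-side₂ : ∀ {b} → b ≢ x₂ → ∀ a → Apart (side₂ b) (side₁ a)
    apart-side₁-from-side₂ b≢x₂ a = no-edge , λ ()
      where
        no-edge : ¬ E (Dumbbell G₁ G₂ x₁ x₂ (suc k)) (side₁ a) (side₂ _)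
        no-edge (inj₁ (_ , b≡x₂ , _)) = b≢x₂ b≡x₂
        no-edge (inj₂ ())

    apart-inner-from-side₂ : ∀ {b} → b ≢ x₂ → ∀ i → Apart (side₂ b) (inner i)
    apart-inner-from-side₂ b≢x₂ i = no-edge , λ ()
      where
        no-edge : ¬ E (Dumbbell G₁ G₂ x₁ x₂ (suc k)) (inner i) (side₂ _)
        no-edge (inj₁ (b≡x₂ , _)) = b≢x₂ b≡x₂
        no-edge (inj₂ ())

  path-bridge₁₂ : ∀ k (ρ : Realization (Dumbbell G₁ G₂ x₁ x₂ (suc k)) T) {a} → a ≢ x₁ →
                  f ρ (inj₁ a) ≺ f ρ (inj₁ x₁) → f ρ (inj₁ a) ≺ f ρ (inj₂ (inj₁ x₂))
  path-bridge₁₂ zero ρ a≢x₁ a≺x₁ =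
    ≺-spreads-along-edge a≺x₁ (inj₁ (refl , refl , refl)) (apart-from-side₁ a≢x₁ (inj₁ x₂))
    where
      open PathDumbbell zero ρ
      open Realized ρ
  path-bridge₁₂ (suc k) ρ {a} a≢x₁ a≺x₁ =
    ≺-spreads-along-edge (a≺inner (fromℕ k)) (inj₁ (refl , cong suc (toℕ-fromℕ k)))
      (apart-from-side₁ a≢x₁ (inj₁ x₂))
    where
      open PathDumbbell (suc k) ρ
      open Realized ρ
      a≺inner : ∀ i → f ρ (side₁ a) ≺ f ρ (inner i)
      a≺inner = <-weakInduction _
        (≺-spreads-along-edge a≺x₁ (inj₁ (refl , refl)) (apart-from-side₁ a≢x₁ (inj₂ zero)))
        λ i a≺i → ≺-spreads-along-edge a≺i (inj₁ (cong suc (sym (toℕ-inject₁ i))))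
                    (apart-from-side₁ a≢x₁ (inj₂ (suc i)))

  path-bridge₂₁ : ∀ k (ρ : Realization (Dumbbell G₁ G₂ x₁ x₂ (suc k)) T) {b} → b ≢ x₂ →
                  f ρ (inj₂ (inj₁ b)) ≺ f ρ (inj₂ (inj₁ x₂)) → f ρ (inj₂ (inj₁ b)) ≺ f ρ (inj₁ x₁)
  path-bridge₂₁ zero ρ b≢x₂ b≺x₂ =
    ≺-spreads-along-edge b≺x₂ (inj₂ (refl , refl , refl)) (apart-side₁-from-side₂ b≢x₂ x₁)
    where
      open PathDumbbell zero ρ
      open Realized ρ
  path-bridge₂₁ (suc k) ρ {b} b≢x₂ b≺x₂ =
    ≺-spreads-along-edge (b≺inner zero) (inj₂ (refl , refl)) (apart-side₁-from-side₂ b≢x₂ x₁)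
    where
      open PathDumbbell (suc k) ρ
      open Realized ρ
      b≺inner : ∀ i → f ρ (side₂ b) ≺ f ρ (inner i)
      b≺inner = >-weakInduction _
        (≺-spreads-along-edge b≺x₂ (inj₂ (refl , cong suc (toℕ-fromℕ k)))
          (apart-inner-from-side₂ b≢x₂ (fromℕ k)))
        λ i b≺i → ≺-spreads-along-edge b≺i (inj₂ (cong suc (sym (toℕ-inject₁ i))))
                    (apart-inner-from-side₂ b≢x₂ (inject₁ i))

  path-split : ∀ k → Realization (Dumbbell G₁ G₂ x₁ x₂ (suc k)) T → LinkedRealizations
  path-split k ρ = record
    { ρ₁ = ρ₁
    ; ρ₂ = ρ₂
    ; linked₁₂ = record
      { apart  = λ a a≢x₁ b _ → apart-in-tree (apart-from-side₁ a≢x₁ (inj₁ b))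
      ; bridge = λ _ → path-bridge₁₂ k ρ }
    ; linked₂₁ = record
      { apart  = λ b b≢x₂ a _ → apart-in-tree (apart-side₁-from-side₂ b≢x₂ a)
      ; bridge = λ _ → path-bridge₂₁ k ρ }
    }
    where
      open PathDumbbell k ρ
      open Realized ρ

  module GluedDumbbell (ρ : Realization (Dumbbell G₁ G₂ x₁ x₂ zero) T) where
    open Realized ρ

    _≟₂_ : (u v : V G₂) → Dec (u ≡ v)
    _≟₂_ = Realized.vertex-≟ (proj₂ (proj₂ d₂))

    glue : (b : V G₂) → Dec (b ≡ x₂) → V₀ G₁ G₂ x₁ x₂
    glue _ (yes _)    = inj₁ x₁
    glue b (no b≢x₂) = inj₂ (b , b≢x₂)

    side₂ : V G₂ → V₀ G₁ G₂ x₁ x₂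
    side₂ b = glue b (b ≟₂ x₂)

    side₂-x₂ : side₂ x₂ ≡ inj₁ x₁
    side₂-x₂ with x₂ ≟₂ x₂
    ... | yes _ = refl
    ... | no x₂≢x₂ = ⊥-elim (x₂≢x₂ refl)

    glue-injective : ∀ {u v} du dv → glue u du ≡ glue v dv → u ≡ v
    glue-injective (yes refl) (yes refl) _    = refl
    glue-injective (no _)     (no _)     refl = refl

    glue-preserves : ∀ {u v} du dv → E G₂ u v →
                     E (Dumbbell G₁ G₂ x₁ x₂ zero) (glue u du) (glue v dv)
    glue-preserves (yes refl) (yes refl) e = ⊥-elim (Realized.edge-irrefl (proj₂ (proj₂ d₂)) e)
    glue-preserves (yes refl) (no _)     e = inj₁ (refl , e)
    glue-preserves (no _)     (yes refl) e = inj₂ (refl , edge-sym₂ e)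
    glue-preserves (no _)     (no _)     e = inj₁ e

    glue-reflects : ∀ {u v} du dv → E (Dumbbell G₁ G₂ x₁ x₂ zero) (glue u du) (glue v dv) →
                    E G₂ u v
    glue-reflects (yes refl) (yes refl) e              = ⊥-elim (edge-irrefl {inj₁ x₁} e)
    glue-reflects (yes refl) (no _)     (inj₁ (_ , e)) = e
    glue-reflects (no _)     (yes refl) (inj₂ (_ , e)) = edge-sym₂ e
    glue-reflects (no _)     (no _)     e              = [ id , edge-sym₂ ] e

    ρ₁ : Realization G₁ T
    ρ₁ = restrict inj₁ inj₁-injective inj₁ [ id , edge-sym₁ ]

    ρ₂ : Realization G₂ T
    ρ₂ = restrict side₂ (λ {u} {v} → glue-injective (u ≟₂ x₂) (v ≟₂ x₂))
                        (λ {u} {v} → glue-preserves (u ≟₂ x₂) (v ≟₂ x₂))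
                        (λ {u} {v} → glue-reflects (u ≟₂ x₂) (v ≟₂ x₂))

    apart-sides : ∀ {a b} → a ≢ x₁ → b ≢ x₂ → Apart (inj₁ a) (side₂ b)
    apart-sides {a} {b} a≢x₁ b≢x₂ = apart-glue (b ≟₂ x₂)
      where
        apart-glue : ∀ db → Apart (inj₁ a) (glue b db)
        apart-glue (yes b≡x₂) = ⊥-elim (b≢x₂ b≡x₂)
        apart-glue (no b≢x₂′) = no-edge , λ ()
          where
            no-edge : ¬ E (Dumbbell G₁ G₂ x₁ x₂ zero) (glue b (no b≢x₂′)) (inj₁ a)
            no-edge (inj₂ (a≡x₁ , _)) = a≢x₁ a≡x₁

  glued-split : Realization (Dumbbell G₁ G₂ x₁ x₂ zero) T → LinkedRealizations
  glued-split ρ = record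
    { ρ₁ = ρ₁
    ; ρ₂ = ρ₂
    ; linked₁₂ = record
      { apart  = λ a a≢x₁ b b≢x₂ → apart-in-tree (apart-sides a≢x₁ b≢x₂)
      ; bridge = λ a _ a≺x₁ → subst (λ v → f ρ (inj₁ a) ≺ f ρ v) (sym side₂-x₂) a≺x₁ }
    ; linked₂₁ = record
      { apart  = λ b b≢x₂ a a≢x₁ → apart-in-tree (apart-sym (apart-sides a≢x₁ b≢x₂))
      ; bridge = λ b _ b≺x₂ → subst (λ v → f ρ (side₂ b) ≺ f ρ v) side₂-x₂ b≺x₂ }
    }
    where
      open GluedDumbbell ρ
      open Realized ρ

  dumbbell-split : ∀ ℓ → Realization (Dumbbell G₁ G₂ x₁ x₂ ℓ) T → LinkedRealizations
  dumbbell-split zero    = glued-split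
  dumbbell-split (suc k) = path-split k

mainTheorem16 : (G₁ G₂ : Graph) (x₁ : V G₁) (x₂ : V G₂) →
                Derived G₁ → Derived G₂ →
                GlobalSubordinate G₁ x₁ → GlobalSubordinate G₂ x₂ →
                (ℓ : ℕ) → ¬ Derived (Dumbbell G₁ G₂ x₁ x₂ ℓ)
mainTheorem16 G₁ G₂ x₁ x₂ d₁ d₂ sub₁ sub₂ ℓ (m , T , ρ) =
  Linking.linked-subordinates-impossible T linked₁₂ linked₂₁ sub₁ sub₂
  where
    open Dumbbells G₁ G₂ x₁ x₂ d₁ d₂ T
    open LinkedRealizations (dumbbell-split ℓ ρ)
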